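{- Let $\mathbf{d}$ be a Dyck path on an $n\times n$ board with bounce number $|\mathbf{m}|=3$ and let $P=P(\mathbf{d})$. Let $T$ be a $P$-tableau, and let $L$ be a vertical sequence of consecutive entries in column $j$ of $T$, where $a_{i,j}$ denotes the entry of $T$ in row $i$ and column $j$. Then for every $i$, there are at most two indices $s$ with $s>i$ (and $a_{i,j},\dots,a_{s,j}$ in $L$) such that $a_{i,j},a_{i+1,j},\dots,a_{s-1,j}\prec a_{s,j}$.
   Context: A Dyck path on an $n\times n$ board is a sequence $\mathbf{d}=(d_1,\dots,d_{n-1})$ of positive integers with $d_1\le\cdots\le d_{n-1}\le n$ and $d_i\ge i$. The poset $P(\mathbf{d})$ on $[n]$ has relations $i\prec j$ iff $i<n$ and $d_i<j\le n$. The bounce sequence $\mathbf{m}=(m_0,\dots,m_l)$ is given by $m_0=d_1$, $m_i=d_{m_{i-1}+1}$, stopping at $m_l=n$; the bounce number is $|\mathbf{m}|=l+1$. A $P$-tableau of shape $\lambda$ is a filling of the Young diagram of $\lambda$ (English convention) with each element of $P$ exactly once such that $a_{i,j}\prec a_{i,j+1}$ and $a_{i+1,j}\not\prec a_{i,j}$ for all $i,j$. -}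

module Defs where

open import Data.Nat using (ℕ; zero; suc; _+_; _∸_; _≤_; _<_; _≤ᵇ_)
open import Data.Bool using (if_then_else_)
open import Data.List using (List; []; _∷_; length)
open import Data.Product using (_×_; ∃-syntax)
open import Relation.Binary.PropositionalEquality using (_≡_; _≢_)
open import Relation.Nullary using (¬_)

-- A Dyck path d = (d₁,…,d_{n-1}) is represented by a function ℕ → ℕ;
-- only the values at indices 1 … n-1 are meaningful.
IsDyck : ℕ → (ℕ → ℕ) → Set
IsDyck n d =
  (∀ i → 1 ≤ i → i < n → i ≤ d i × d i ≤ n) ×
  (∀ i → 1 ≤ i → suc i < n → d i ≤ d (suc i))

-- d extended by the convention d_i = n for i ≥ n (the bounce path stops at n).
dExt : ℕ → (ℕ → ℕ) → ℕ → ℕ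
dExt n d i = if n ≤ᵇ i then n else d i

bounce : ℕ → (ℕ → ℕ) → ℕ → ℕ
bounce n d zero    = dExt n d 1
bounce n d (suc k) = dExt n d (bounce n d k + 1)

-- bounce number |m| = l + 1, where l is the first index with m_l = n
HasBounceNumber : ℕ → (ℕ → ℕ) → ℕ → Set
HasBounceNumber n d b =
  (∀ k → suc k < b → bounce n d k ≢ n) × (1 ≤ b) × (bounce n d (b ∸ 1) ≡ n)

Prec : ℕ → (ℕ → ℕ) → ℕ → ℕ → Set
Prec n d i j = 1 ≤ i × i < n × d i < j × j ≤ n

-- Young diagrams: a shape is the list of row lengths (rows and columns 0-indexed)
rowLen : List ℕ → ℕ → ℕ
rowLen []       _       = 0
rowLen (r ∷ _)  zero    = r
rowLen (_ ∷ rs) (suc i) = rowLen rs i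

IsPartition : List ℕ → Set
IsPartition sh =
  (∀ i → i < length sh → 1 ≤ rowLen sh i) ×
  (∀ i → rowLen sh (suc i) ≤ rowLen sh i)

Cell : List ℕ → ℕ → ℕ → Set
Cell sh i j = j < rowLen sh i

-- T i j is the entry a_{i,j} (row i, column j, 0-indexed)
IsPTableau : ℕ → (ℕ → ℕ) → List ℕ → (ℕ → ℕ → ℕ) → Set
IsPTableau n d sh T =
  (∀ i j → Cell sh i j → 1 ≤ T i j × T i j ≤ n) ×
  (∀ i j i' j' → Cell sh i j → Cell sh i' j' → T i j ≡ T i' j' → i ≡ i' × j ≡ j') ×
  (∀ x → 1 ≤ x → x ≤ n → ∃[ i ] ∃[ j ] (Cell sh i j × T i j ≡ x)) ×
  (∀ i j → Cell sh i (suc j) → Prec n d (T i j) (T i (suc j))) ×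
  (∀ i j → Cell sh (suc i) j → ¬ Prec n d (T (suc i) j) (T i j))

AllAbovePrec : ℕ → (ℕ → ℕ) → (ℕ → ℕ → ℕ) → ℕ → ℕ → ℕ → Set
AllAbovePrec n d T j i s = ∀ k → i ≤ k → k < s → Prec n d (T k j) (T s j)

-- A chain a ≺ b ≺ c ≺ e in P(d) outruns the bounce path: d₁ ≤ d_a < b gives m₀ < b,
-- then m₀ + 1 ≤ b gives m₁ = d_{m₀+1} ≤ d_b < c, and likewise m₂ < e. With bounce
-- number 3 we have m₂ = n ≥ e, so P(d) has no chain of four elements; three indices
-- s₁ < s₂ < s₃ as in the statement would give the chain a_{i,j} ≺ a_{s₁,j} ≺ a_{s₂,j} ≺ a_{s₃,j}.
module Submission where

open import Defs
open import Data.Nat using (ℕ; zero; suc; _+_; _≤_; _<_; _≤ᵇ_)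
open import Data.Nat.Properties
open import Data.List using (List)
open import Data.Sum using (inj₁; inj₂)
open import Data.Empty using (⊥)
open import Data.Bool using (true; false)
open import Data.Product using (_,_; proj₁; proj₂)
open import Relation.Nullary using (ofʸ; contradiction)
open import Relation.Binary.PropositionalEquality using (_≡_; refl; sym; subst)

dExt-below : ∀ n d {x} → x < n → dExt n d x ≡ d x
dExt-below n d {x} x<n with n ≤ᵇ x | ≤ᵇ-reflects-≤ n x
... | false | _        = refl
... | true  | ofʸ n≤x = contradiction n≤x (<⇒≱ x<n)

module _ {n : ℕ} {d : ℕ → ℕ} (D : IsDyck n d) where

  dyck-mono : ∀ {p q} → 1 ≤ p → p ≤ q → q < n → d p ≤ d q
  dyck-mono {q = zero}  1≤p p≤0 _ = contradiction (≤-trans 1≤p p≤0) λ ()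
  dyck-mono {q = suc q} 1≤p p≤q q<n with m≤n⇒m<n∨m≡n p≤q
  ... | inj₂ refl = ≤-refl
  ... | inj₁ p<q  = ≤-trans (dyck-mono 1≤p (≤-pred p<q) (<-trans (n<1+n q) q<n))
                            (proj₂ D q (≤-trans 1≤p (≤-pred p<q)) q<n)

  -- Both m₀ = dExt n d (0 + 1) and m_{k+1} = dExt n d (m_k + 1) are instances of the conclusion.
  dExt-suc-<-of-prec : ∀ {m b c} → m < b → Prec n d b c → dExt n d (m + 1) < c
  dExt-suc-<-of-prec {m} {b} m<b (_ , b<n , db<c , _) =
    subst (_< _) (sym (dExt-below n d m+1<n))
      (≤-<-trans (dyck-mono (m≤n+m 1 m) m+1≤b b<n) db<c)
    where
    m+1≤b : m + 1 ≤ b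
    m+1≤b = subst (_≤ b) (+-comm 1 m) m<b
    m+1<n : m + 1 < n
    m+1<n = ≤-<-trans m+1≤b b<n

lemma3p4 : (n : ℕ) (d : ℕ → ℕ) → IsDyck n d → HasBounceNumber n d 3 →
    (sh : List ℕ) → IsPartition sh → (T : ℕ → ℕ → ℕ) → IsPTableau n d sh T →
    (j r₀ r₁ : ℕ) → (∀ r → r₀ ≤ r → r ≤ r₁ → Cell sh r j) →
    (i : ℕ) → r₀ ≤ i → (s₁ s₂ s₃ : ℕ) → i < s₁ → s₁ < s₂ → s₂ < s₃ → s₃ ≤ r₁ →
    AllAbovePrec n d T j i s₁ → AllAbovePrec n d T j i s₂ → AllAbovePrec n d T j i s₃ → ⊥
lemma3p4 n d D (_ , _ , m₂≡n) sh _ T _ j r₀ r₁ _ i _ s₁ s₂ s₃ i<s₁ s₁<s₂ s₂<s₃ _ A₁ A₂ A₃ =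
  <⇒≱ (subst (_< T s₃ j) m₂≡n m₂<e) e≤n
  where
  a≺b : Prec n d (T i j) (T s₁ j)
  a≺b = A₁ i ≤-refl i<s₁
  b≺c : Prec n d (T s₁ j) (T s₂ j)
  b≺c = A₂ s₁ (<⇒≤ i<s₁) s₁<s₂
  c≺e : Prec n d (T s₂ j) (T s₃ j)
  c≺e = A₃ s₂ (<⇒≤ (<-trans i<s₁ s₁<s₂)) s₂<s₃
  m₀<b : bounce n d 0 < T s₁ j
  m₀<b = dExt-suc-<-of-prec D (proj₁ a≺b) a≺b
  m₁<c : bounce n d 1 < T s₂ j
  m₁<c = dExt-suc-<-of-prec D m₀<b b≺c
  m₂<e : bounce n d 2 < T s₃ j
  m₂<e = dExt-suc-<-of-prec D m₁<c c≺e
  e≤n : T s₃ j ≤ n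
  e≤n = let (_ , _ , _ , e≤n) = c≺e in e≤n
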